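{- Let $k\ge 2$ be a fixed integer and assume the Unbalanced Supersaturation Conjecture for this $k$: there is a constant $c_k>0$ such that every bipartite graph with bipartition $A\sqcup B$, $m$ edges and $t$ cycles of length $2k$, with $m\ge 100k(|A|+|B|+(|A||B|)^{(k+1)/(2k)})$, satisfies $t\ge c_k\, m^{2k}/(|A|^k|B|^k)$. Then for every graph $G$ with $t$ cycles of length $2k$ and any vertex subsets $A,B\subseteq V(G)$, not necessarily disjoint, \[ e(A,B)\le O\!\left(|A|+|B|+(|A||B|)^{(k+1)/(2k)}+t^{1/(2k)}\sqrt{|A||B|}\right). \]
   Context: $e(A,B)$ denotes the number of edges of $G$ with one endpoint in $A$ and the other in $B$. The implied constant depends only on $k$. -}

module Defs where

open import Data.Nat using (ℕ; zero; suc; _+_; _*_; _∸_; _^_; _≤_)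
open import Data.Nat.DivMod using (_/_)
open import Data.Bool using (Bool; true; false; _∧_; _∨_; not; if_then_else_; T)
open import Data.Fin using (Fin; zero; suc; _≟_; _<?_; splitAt)
open import Data.Fin.Subset using (Subset; _∈_)
open import Data.Vec using (Vec; []; _∷_; lookup)
open import Data.List using (List; []; _∷_; map; concatMap; allFin)
open import Data.Nat.ListAction using (sum)
open import Data.Sum using (inj₁; inj₂)
open import Data.Product using (_×_; ∃-syntax)
open import Relation.Nullary.Decidable using (⌊_⌋)
open import Relation.Binary.PropositionalEquality using (_≡_; refl)
import Data.Vec

record Graph (n : ℕ) : Set where
  field
    adj   : Fin n → Fin n → Bool
    sym   : ∀ u v → adj u v ≡ adj v u
    irrfl : ∀ v → adj v v ≡ false
open Graph public

count : (n : ℕ) → (Fin n → Bool) → ℕ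
count n p = sum (map (λ i → if p i then 1 else 0) (allFin n))

mem : ∀ {n} → Fin n → Subset n → Bool
mem i A = lookup A i

-- e(A,B): number of (unordered) edges uv with one endpoint in A and the
-- other in B (A, B need not be disjoint; each edge counted once).
eAB : ∀ {n} → Graph n → Subset n → Subset n → ℕ
eAB {n} G A B =
  sum (map (λ u → count n (λ v →
    ⌊ u <? v ⌋ ∧ adj G u v ∧
      ((mem u A ∧ mem v B) ∨ (mem u B ∧ mem v A))))
       (allFin n))

allVecs : (n L : ℕ) → List (Vec (Fin n) L)
allVecs n zero = [] ∷ []
allVecs n (suc L) = concatMap (λ i → map (i ∷_) (allVecs n L)) (allFin n)

allB : {A : Set} → (A → Bool) → List A → Bool
allB p [] = true
allB p (x ∷ xs) = p x ∧ allB p xs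

walkB : ∀ {n} → Graph n → List (Fin n) → Bool
walkB G [] = true
walkB G (x ∷ []) = true
walkB G (x ∷ y ∷ xs) = adj G x y ∧ walkB G (y ∷ xs)

-- v is a closed walk v0 v1 ... v(L-1) v0 in G with pairwise distinct
-- vertices, i.e. a labelled (rooted, oriented) cycle of length L
cycleSeqB : ∀ {n L} → Graph n → Vec (Fin n) L → Bool
cycleSeqB G [] = false
cycleSeqB {n} {suc L} G (x ∷ xs) =
  walkB G (x ∷ Data.Vec.toList xs) ∧
  adj G (Data.Vec.last (x ∷ xs)) x ∧
  allB (λ i → allB (λ j → not ⌊ i <? j ⌋ ∨ not ⌊ lookup (x ∷ xs) i ≟ lookup (x ∷ xs) j ⌋)
                   (allFin (suc L)))
       (allFin (suc L))

labelledCycles : ∀ {n} → Graph n → ℕ → ℕ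
labelledCycles {n} G L = sum (map (λ v → if cycleSeqB G v then 1 else 0) (allVecs n L))

-- number of cycles of length L (subgraphs isomorphic to C_L), L ≥ 3:
-- each such cycle corresponds to exactly 2L labelled cycles.
-- (suc (2 * l + 1) = 2 * (l + 1).)
cycles : ∀ {n} → Graph n → ℕ → ℕ
cycles G zero = 0
cycles G (suc l) = labelledCycles G (suc l) / suc (2 * l + 1)

bipGraph : ∀ {a b} → (Fin a → Fin b → Bool) → Graph (a + b)
bipGraph {a} {b} R = record { adj = ad ; sym = sy ; irrfl = ir }
  where
    ad : Fin (a + b) → Fin (a + b) → Bool
    ad u v with splitAt a u | splitAt a v
    ... | inj₁ x | inj₂ y = R x y
    ... | inj₂ y | inj₁ x = R x y
    ... | inj₁ _ | inj₁ _ = false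
    ... | inj₂ _ | inj₂ _ = false
    sy : ∀ u v → ad u v ≡ ad v u
    sy u v with splitAt a u | splitAt a v
    ... | inj₁ x | inj₂ y = refl
    ... | inj₂ y | inj₁ x = refl
    ... | inj₁ _ | inj₁ _ = refl
    ... | inj₂ _ | inj₂ _ = refl
    ir : ∀ v → ad v v ≡ false
    ir v with splitAt a v
    ... | inj₁ _ = refl
    ... | inj₂ _ = refl

bipEdges : ∀ {a b} → (Fin a → Fin b → Bool) → ℕ
bipEdges {a} {b} R = sum (map (λ x → count b (λ y → R x y)) (allFin a))

-- Unbalanced Supersaturation Conjecture for k, with the positive real
-- constant c_k written as 1/d (d ≥ 1), and the condition
-- m ≥ 100k(|A|+|B|+(|A||B|)^((k+1)/(2k))) written without real powers:
-- m ≥ 100k(|A|+|B|) and (m − 100k(|A|+|B|))^(2k) ≥ (100k)^(2k) (|A||B|)^(k+1).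
-- Conclusion t ≥ m^(2k)/(d |A|^k |B|^k) written as m^(2k) ≤ d t |A|^k |B|^k.
USC : ℕ → Set
USC k = ∃[ d ] (1 ≤ d × (∀ a b (R : Fin a → Fin b → Bool) →
  let m = bipEdges R
      t = cycles (bipGraph R) (2 * k)
  in 100 * k * (a + b) ≤ m →
     (100 * k) ^ (2 * k) * (a * b) ^ (k + 1) ≤ (m ∸ 100 * k * (a + b)) ^ (2 * k) →
     m ^ (2 * k) ≤ d * t * a ^ k * b ^ k))

-- Count the edges between A and B through the arcs (u, v) with u ∈ A, v ∈ B and uv an edge:
-- every edge yields at least one arc. Derandomising a uniformly random split s of the vertices
-- (method of conditional expectations) keeps a quarter of the arcs going from A ∩ s to B ∖ s.
-- These arcs form a bipartite graph H on the disjoint sides A ∩ s and B ∖ s; H embeds in G, so it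
-- has no more 2k-cycles than G, and its sides are no larger than A and B. The conjecture applied
-- to H says that either m = e(H) is below its threshold, or m^(2k) ≤ d t |A|^k |B|^k. Both give
-- the bound, with the roots (|A||B|)^((k+1)/(2k)) and (t (|A||B|)^k)^(1/(2k)) replaced by their
-- integer parts y₁, y₂; the rounding is absorbed into the constant.
module Submission where

open import Algebra.Bundles using (CommutativeMonoid)
open import Data.Bool using (Bool; true; false; _∧_; _∨_; not; if_then_else_; T)
open import Data.Bool.Properties
  using (T-∧; ∧-comm; ∧-zeroʳ; not-involutive; if-not; if-cong; if-eta; if-∧; ∧-commutativeMonoid)
open import Algebra.Properties.CommutativeSemigroup (CommutativeMonoid.commutativeSemigroup ∧-commutativeMonoid)
  using () renaming (interchange to ∧-interchange)
open import Data.Empty using (⊥; ⊥-elim)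
open import Data.Fin using (Fin; zero; suc; punchIn; punchOut; splitAt; join)
open import Data.Fin.Properties using (punchOut-injective; punchIn-punchOut; join-splitAt)
import Data.Fin.Properties as Finₚ
open import Data.Fin.Subset using (Subset; ∣_∣; ∁; _∩_)
open import Data.Fin.Subset.Properties using (∣p∩q∣≤∣p∣)
open import Data.List using (List; []; _∷_; _++_; map; tabulate; allFin; concatMap)
open import Data.List.Properties using (map-++; map-cong; map-∘)
open import Data.Nat
  using (ℕ; zero; suc; _+_; _*_; _∸_; _^_; _≤_; _<_; z≤n; s≤s; z<s; NonZero; >-nonZero; >-nonZero⁻¹)
open import Data.Nat.DivMod using (/-monoˡ-≤)
import Data.Nat.ListAction as List
open import Data.Nat.ListAction.Properties using (sum-++)
open import Data.Nat.Properties hiding (_≟_)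
open import Data.Nat.Solver using (module +-*-Solver)
open +-*-Solver
open import Algebra.Properties.CommutativeMonoid.Sum +-0-commutativeMonoid
  using (sum-syntax; ∑-distrib-+; ∑-comm; sum-cong-≗; sum-remove; sum-replicate-zero)
open import Data.Product using (_×_; _,_; ∃-syntax; proj₁; proj₂)
open import Data.Sum using (inj₁; inj₂; [_,_]′)
open import Data.Vec using (Vec; []; _∷_)
import Data.Vec as Vec
open import Data.Vec.Properties using (lookup-map; lookup-zipWith; toList-map)
open import Function using (_∘_; flip; Equivalence; mk⇔)
open import Function.Definitions using (Injective)
open import Relation.Binary.PropositionalEquality
open import Relation.Nullary using (yes; no)
open import Relation.Nullary.Decidable using (⌊_⌋; does; isYes≗does; does-⇔)

open import Defs hiding (sym)

∑-mono-≤ : ∀ {n} {f g : Fin n → ℕ} → (∀ i → f i ≤ g i) → ∑[ i < n ] f i ≤ ∑[ i < n ] g i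
∑-mono-≤ {zero}  f≤g = z≤n
∑-mono-≤ {suc n} f≤g = +-mono-≤ (f≤g zero) (∑-mono-≤ (f≤g ∘ suc))

sum-map-tabulate : ∀ {A : Set} {n} (g : A → ℕ) (f : Fin n → A) →
                   List.sum (map g (tabulate f)) ≡ ∑[ i < n ] g (f i)
sum-map-tabulate {n = zero}  g f = refl
sum-map-tabulate {n = suc n} g f = cong (g (f zero) +_) (sum-map-tabulate g (f ∘ suc))

sum-map-allFin : ∀ {n} (g : Fin n → ℕ) → List.sum (map g (allFin n)) ≡ ∑[ i < n ] g i
sum-map-allFin g = sum-map-tabulate g (λ i → i)

∑-injective-≤ : ∀ {m n} (h : Fin m → Fin n) → Injective _≡_ _≡_ h →
                (f : Fin n → ℕ) → ∑[ i < m ] f (h i) ≤ ∑[ j < n ] f j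
∑-injective-≤ {zero}          h inj f = z≤n
∑-injective-≤ {suc m} {zero}  h inj f with h zero
... | ()
∑-injective-≤ {suc m} {suc n} h inj f = begin
  f (h zero) + ∑[ i < m ] f (h (suc i))
    ≡⟨ cong (f (h zero) +_) (sum-cong-≗ (λ i → cong f (sym (punchIn-punchOut (h0≢ i))))) ⟩
  f (h zero) + ∑[ i < m ] f (punchIn (h zero) (h′ i))
    ≤⟨ +-monoʳ-≤ (f (h zero)) (∑-injective-≤ h′ h′-injective (f ∘ punchIn (h zero))) ⟩
  f (h zero) + ∑[ j < n ] f (punchIn (h zero) j)
    ≡⟨ sum-remove {i = h zero} f ⟨
  ∑[ j < suc n ] f j ∎
  where
  open ≤-Reasoning
  h0≢ : ∀ i → h zero ≢ h (suc i)
  h0≢ i e with inj e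
  ... | ()
  h′ : Fin m → Fin n
  h′ i = punchOut (h0≢ i)
  h′-injective : Injective _≡_ _≡_ h′
  h′-injective e = Finₚ.suc-injective (inj (punchOut-injective (h0≢ _) (h0≢ _) e))

ind : Bool → ℕ → ℕ
ind b x = if b then x else 0

ind-∑ : ∀ b {n} (f : Fin n → ℕ) → ind b (∑[ i < n ] f i) ≡ ∑[ i < n ] ind b (f i)
ind-∑ true      f = refl
ind-∑ false {n} f = sym (sum-replicate-zero n)

ind-1-mono : ∀ {b c} → (T b → T c) → ind b 1 ≤ ind c 1
ind-1-mono {false}         _   = z≤n
ind-1-mono {true}  {true}  _   = ≤-refl
ind-1-mono {true}  {false} b⇒c = ⊥-elim (b⇒c _)

ind-∧-interchange : ∀ a b c d x → ind (a ∧ b) (ind (c ∧ d) x) ≡ ind (b ∧ d) (ind (a ∧ c) x)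
ind-∧-interchange a b c d x = begin
  ind (a ∧ b) (ind (c ∧ d) x)  ≡⟨ if-∧ (a ∧ b) ⟨
  ind ((a ∧ b) ∧ (c ∧ d)) x    ≡⟨ cong (λ p → ind p x) (∧-interchange a b c d) ⟩
  ind ((a ∧ c) ∧ (b ∧ d)) x    ≡⟨ cong (λ p → ind p x) (∧-comm (a ∧ c) (b ∧ d)) ⟩
  ind ((b ∧ d) ∧ (a ∧ c)) x    ≡⟨ if-∧ (b ∧ d) ⟩
  ind (b ∧ d) (ind (a ∧ c) x)  ∎
  where open ≡-Reasoning

ind-∨-≤ : ∀ l c x y → ind (l ∧ c ∧ (x ∨ y)) 1 ≤ ind l (ind x (ind c 1)) + ind l (ind y (ind c 1))
ind-∨-≤ false c     x     y     = z≤n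
ind-∨-≤ true  false x     y     = z≤n
ind-∨-≤ true  true  true  y     = s≤s z≤n
ind-∨-≤ true  true  false true  = ≤-refl
ind-∨-≤ true  true  false false = z≤n

mem-∁ : ∀ {n} (u : Fin n) s → mem u (∁ s) ≡ not (mem u s)
mem-∁ u s = lookup-map u not s

mem-∩ : ∀ {n} (u : Fin n) p q → mem u (p ∩ q) ≡ mem u p ∧ mem u q
mem-∩ u p q = lookup-zipWith _∧_ u p q

enum : ∀ {n} (p : Subset n) → Fin ∣ p ∣ → Fin n
enum (true  ∷ p) zero    = zero
enum (true  ∷ p) (suc i) = suc (enum p i)
enum (false ∷ p) i       = suc (enum p i)

mem-enum : ∀ {n} (p : Subset n) i → T (mem (enum p i) p)
mem-enum (true  ∷ p) zero    = _
mem-enum (true  ∷ p) (suc i) = mem-enum p i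
mem-enum (false ∷ p) i       = mem-enum p i

enum-injective : ∀ {n} (p : Subset n) → Injective _≡_ _≡_ (enum p)
enum-injective (true  ∷ p) {zero}  {zero}  e = refl
enum-injective (true  ∷ p) {suc i} {suc j} e = cong suc (enum-injective p (Finₚ.suc-injective e))
enum-injective (false ∷ p)                 e = enum-injective p (Finₚ.suc-injective e)

∑-enum : ∀ {n} (p : Subset n) (f : Fin n → ℕ) →
         ∑[ i < ∣ p ∣ ] f (enum p i) ≡ ∑[ u < n ] ind (mem u p) (f u)
∑-enum []          f = refl
∑-enum (true  ∷ p) f = cong (f zero +_) (∑-enum p (f ∘ suc))
∑-enum (false ∷ p) f = ∑-enum p (f ∘ suc)

Disjoint : ∀ {n} → Subset n → Subset n → Set
Disjoint p q = ∀ u → T (mem u p) → T (mem u q) → ⊥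

∩-∩∁-disjoint : ∀ {n} (A B s : Subset n) → Disjoint (A ∩ s) (B ∩ ∁ s)
∩-∩∁-disjoint A B s u u∈A∩s u∈B∩∁s = not-T (mem u s) (second (subst T (mem-∩ u A s) u∈A∩s))
  (subst T (mem-∁ u s) (second (subst T (mem-∩ u B (∁ s)) u∈B∩∁s)))
  where
  second : ∀ {a b} → T (a ∧ b) → T b
  second = proj₂ ∘ Equivalence.to T-∧
  not-T : ∀ b → T b → T (not b) → ⊥
  not-T true _ ()

-- Large directed cuts

module _ {n : ℕ} where

  total : (Fin n → Fin n → ℕ) → ℕ
  total w = ∑[ u < n ] ∑[ v < n ] w u v

  cut : (Fin n → Fin n → ℕ) → Subset n → ℕ
  cut w s = ∑[ u < n ] ∑[ v < n ] ind (mem u s ∧ not (mem v s)) (w u v)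

  gain : (Fin n → ℕ) → (Fin n → ℕ) → Subset n → ℕ
  gain α β s = ∑[ u < n ] (if mem u s then α u else β u)

  -- The right-hand side is four times the expectation of cut w s + gain α β s for a uniformly
  -- random s; the method of conditional expectations finds an s beating the average.
  LargeCut : (Fin n → Fin n → ℕ) → (Fin n → ℕ) → (Fin n → ℕ) → Subset n → Set
  LargeCut w α β s = total w + 2 * ∑[ u < n ] (α u + β u) ≤ 4 * (cut w s + gain α β s)

  total-mono-≤ : {w w′ : Fin n → Fin n → ℕ} → (∀ u v → w u v ≤ w′ u v) → total w ≤ total w′
  total-mono-≤ w≤w′ = ∑-mono-≤ λ u → ∑-mono-≤ (w≤w′ u)

  total-+ : (w w′ : Fin n → Fin n → ℕ) → total (λ u v → w u v + w′ u v) ≡ total w + total w′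
  total-+ w w′ = trans (sum-cong-≗ {n} λ u → ∑-distrib-+ (w u) (w′ u))
                       (∑-distrib-+ (λ u → ∑[ v < n ] w u v) (λ u → ∑[ v < n ] w′ u v))

LargeCuts : ℕ → Set
LargeCuts n = (w : Fin n → Fin n → ℕ) (α β : Fin n → ℕ) → (∀ u → w u u ≡ 0) →
              ∃[ s ] LargeCut w α β s

module _ {n : ℕ} (w : Fin n → Fin n → ℕ) where

  total-flip : total (flip w) ≡ total w
  total-flip = ∑-comm (flip w)

  cut-flip : ∀ s → cut (flip w) s ≡ cut w (∁ s)
  cut-flip s = trans (∑-comm (λ u v → ind (mem u s ∧ not (mem v s)) (w v u)))
    (sum-cong-≗ λ u → sum-cong-≗ λ v → cong (λ b → ind b (w u v)) (begin
      mem v s ∧ not (mem u s)              ≡⟨ ∧-comm (mem v s) _ ⟩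
      not (mem u s) ∧ mem v s              ≡⟨ cong (not (mem u s) ∧_) (not-involutive (mem v s)) ⟨
      not (mem u s) ∧ not (not (mem v s))  ≡⟨ cong₂ (λ a b → a ∧ not b) (mem-∁ u s) (mem-∁ v s) ⟨
      mem u (∁ s) ∧ not (mem v (∁ s))      ∎))
    where open ≡-Reasoning

  gain-∁ : ∀ α β s → gain β α s ≡ gain α β (∁ s)
  gain-∁ α β s = sum-cong-≗ {n} λ u → trans (sym (if-not (mem u s))) (if-cong (sym (mem-∁ u s)))

  largeCut-flip : ∀ {α β s} → LargeCut (flip w) β α s → LargeCut w α β (∁ s)
  largeCut-flip {α} {β} {s} = subst₂ _≤_
    (cong₂ (λ t x → t + 2 * x) total-flip (sum-cong-≗ λ u → +-comm (β u) (α u)))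
    (cong₂ (λ c g → 4 * (c + g)) (cut-flip s) (gain-∁ α β s))

conditional-expectation-step : ∀ {out in′ t a b r c g x} →
  in′ + 2 * b ≤ out + 2 * a → t + 2 * (x + out) ≤ 4 * (c + (g + r)) →
  out + in′ + t + 2 * (a + b + x) ≤ 4 * (r + c + (a + g))
conditional-expectation-step {out} {in′} {t} {a} {b} {r} {c} {g} {x} h IH = begin
  out + in′ + t + 2 * (a + b + x)
    ≡⟨ solve 6 (λ out in′ t a b x → out :+ in′ :+ t :+ con 2 :* (a :+ b :+ x)
                                  := (in′ :+ con 2 :* b) :+ (out :+ t :+ con 2 :* x :+ con 2 :* a))
               refl out in′ t a b x ⟩
  (in′ + 2 * b) + (out + t + 2 * x + 2 * a)
    ≤⟨ +-monoˡ-≤ _ h ⟩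
  (out + 2 * a) + (out + t + 2 * x + 2 * a)
    ≡⟨ solve 4 (λ out t a x → (out :+ con 2 :* a) :+ (out :+ t :+ con 2 :* x :+ con 2 :* a)
                            := (t :+ con 2 :* (x :+ out)) :+ con 4 :* a)
               refl out t a x ⟩
  (t + 2 * (x + out)) + 4 * a
    ≤⟨ +-monoˡ-≤ _ IH ⟩
  4 * (c + (g + r)) + 4 * a
    ≡⟨ solve 4 (λ r c a g → con 4 :* (c :+ (g :+ r)) :+ con 4 :* a := con 4 :* (r :+ c :+ (a :+ g)))
               refl r c a g ⟩
  4 * (r + c + (a + g)) ∎
  where open ≤-Reasoning

largeCut-inside : ∀ {n} → LargeCuts n →
  (w : Fin (suc n) → Fin (suc n) → ℕ) (α β : Fin (suc n) → ℕ) → (∀ u → w u u ≡ 0) →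
  ∑[ v < n ] w (suc v) zero + 2 * β zero ≤ ∑[ v < n ] w zero (suc v) + 2 * α zero →
  ∃[ s ] LargeCut w α β s
largeCut-inside {n} largeCuts-n w α β w-diag h = true ∷ s , bound
  where
  w′ : Fin n → Fin n → ℕ
  w′ u v = w (suc u) (suc v)
  -- Once 0 ∈ s, a vertex u put outside s also cuts the arc (0, u).
  β′ : Fin n → ℕ
  β′ u = β (suc u) + w zero (suc u)
  IH = largeCuts-n w′ (α ∘ suc) β′ (w-diag ∘ suc)
  s = proj₁ IH
  out in′ cut₀ : ℕ
  out  = ∑[ v < n ] w zero (suc v)
  in′  = ∑[ v < n ] w (suc v) zero
  cut₀ = ∑[ v < n ] ind (not (mem v s)) (w zero (suc v))

  total-split : total w ≡ out + in′ + total w′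
  total-split = begin
    (w zero zero + out) + ∑[ u < n ] (w (suc u) zero + ∑[ v < n ] w′ u v)
      ≡⟨ cong₂ _+_ (cong (_+ out) (w-diag zero))
                   (∑-distrib-+ (λ u → w (suc u) zero) (λ u → ∑[ v < n ] w′ u v)) ⟩
    out + (in′ + total w′)
      ≡⟨ +-assoc out in′ (total w′) ⟨
    out + in′ + total w′ ∎
    where open ≡-Reasoning

  cut-split : cut w (true ∷ s) ≡ cut₀ + cut w′ s
  cut-split = cong (cut₀ +_) (sum-cong-≗ λ u →
    cong (λ b → ind b (w (suc u) zero) + ∑[ v < n ] ind (mem u s ∧ not (mem v s)) (w′ u v))
         (∧-zeroʳ (mem u s)))

  gain-split : gain (α ∘ suc) β′ s ≡ gain (α ∘ suc) (β ∘ suc) s + cut₀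
  gain-split = trans (sum-cong-≗ λ u → if-else-+ (mem u s))
    (∑-distrib-+ (λ u → if mem u s then α (suc u) else β (suc u))
                 (λ u → ind (not (mem u s)) (w zero (suc u))))
    where
    if-else-+ : ∀ b {x y z} → (if b then x else (y + z)) ≡ (if b then x else y) + ind (not b) z
    if-else-+ true  = sym (+-identityʳ _)
    if-else-+ false = refl

  weights-split : ∑[ u < n ] (α (suc u) + β′ u) ≡ ∑[ u < n ] (α (suc u) + β (suc u)) + out
  weights-split = trans (sum-cong-≗ λ u → sym (+-assoc (α (suc u)) (β (suc u)) (w zero (suc u))))
    (∑-distrib-+ (λ u → α (suc u) + β (suc u)) (λ u → w zero (suc u)))

  bound : LargeCut w α β (true ∷ s)
  bound = subst₂ _≤_
    (cong (λ t → t + 2 * ∑[ u < suc n ] (α u + β u)) (sym total-split))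
    (cong (λ c → 4 * (c + gain α β (true ∷ s))) (sym cut-split))
    (conditional-expectation-step {t = total w′} {a = α zero} {b = β zero} {r = cut₀} {c = cut w′ s}
      {g = gain (α ∘ suc) (β ∘ suc) s} {x = ∑[ u < n ] (α (suc u) + β (suc u))} h
      (subst₂ _≤_ (cong (λ x → total w′ + 2 * x) weights-split)
                  (cong (λ g → 4 * (cut w′ s + g)) gain-split)
                  (proj₂ IH)))

-- Putting 0 outside s amounts to putting 0 inside for the reversed arcs and complementing s.
largeCuts : ∀ n → LargeCuts n
largeCuts zero    w α β w-diag = [] , z≤n
largeCuts (suc n) w α β w-diag with ≤-total (∑[ v < n ] w (suc v) zero + 2 * β zero)
                                            (∑[ v < n ] w zero (suc v) + 2 * α zero)
... | inj₁ h = largeCut-inside (largeCuts n) w α β w-diag h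
... | inj₂ h with largeCut-inside (largeCuts n) (flip w) β α w-diag h
...   | s , bound = ∁ s , largeCut-flip w {α} {β} {s} bound

largeCut : ∀ {n} (w : Fin n → Fin n → ℕ) → (∀ u → w u u ≡ 0) → ∃[ s ] total w ≤ 4 * cut w s
largeCut {n} w w-diag with largeCuts n w (λ _ → 0) (λ _ → 0) w-diag
... | s , bound = s , (begin
  total w                                 ≤⟨ m≤m+n (total w) _ ⟩
  total w + 2 * ∑[ u < n ] 0              ≤⟨ bound ⟩
  4 * (cut w s + gain (λ _ → 0) (λ _ → 0) s) ≡⟨ cong (λ g → 4 * (cut w s + g)) gain-zero ⟩
  4 * (cut w s + 0)                       ≡⟨ cong (4 *_) (+-identityʳ (cut w s)) ⟩
  4 * cut w s ∎)
  where
  open ≤-Reasoning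
  gain-zero : gain (λ _ → 0) (λ _ → 0) s ≡ 0
  gain-zero = trans (sum-cong-≗ λ u → if-eta (mem u s)) (sum-replicate-zero n)

-- Embeddings and cycle counts

record Embedding {m n} (H : Graph m) (G : Graph n) : Set where
  field
    f             : Fin m → Fin n
    injective     : Injective _≡_ _≡_ f
    preserves-adj : ∀ u v → T (adj H u v) → T (adj G (f u) (f v))

last-map : ∀ {A B : Set} {L} (g : A → B) (v : Vec A (suc L)) → Vec.last (Vec.map g v) ≡ g (Vec.last v)
last-map g (x ∷ [])     = refl
last-map g (x ∷ y ∷ ys) = last-map g (y ∷ ys)

allB-cong : ∀ {A : Set} {p q : A → Bool} → (∀ x → p x ≡ q x) → ∀ xs → allB p xs ≡ allB q xs
allB-cong p≗q []       = refl
allB-cong p≗q (x ∷ xs) = cong₂ _∧_ (p≗q x) (allB-cong p≗q xs)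

-- Definitionally the last conjunct of cycleSeqB.
distinctB : ∀ {n L} → Vec (Fin n) L → Bool
distinctB {L = L} v =
  allB (λ i → allB (λ j → not ⌊ i Finₚ.<? j ⌋ ∨ not ⌊ Vec.lookup v i Finₚ.≟ Vec.lookup v j ⌋)
                   (allFin L))
       (allFin L)

sum-map-concatMap : ∀ {A B : Set} (F : B → ℕ) (g : A → List B) xs →
                    List.sum (map F (concatMap g xs)) ≡ List.sum (map (λ x → List.sum (map F (g x))) xs)
sum-map-concatMap F g []       = refl
sum-map-concatMap F g (x ∷ xs) = begin
  List.sum (map F (g x ++ concatMap g xs))                 ≡⟨ cong List.sum (map-++ F (g x) _) ⟩
  List.sum (map F (g x) ++ map F (concatMap g xs))         ≡⟨ sum-++ (map F (g x)) _ ⟩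
  List.sum (map F (g x)) + List.sum (map F (concatMap g xs)) ≡⟨ cong (_ +_) (sum-map-concatMap F g xs) ⟩
  List.sum (map F (g x)) + List.sum (map (λ x → List.sum (map F (g x))) xs) ∎
  where open ≡-Reasoning

sum-map-allVecs-suc : ∀ m L (F : Vec (Fin m) (suc L) → ℕ) →
  List.sum (map F (allVecs m (suc L))) ≡ ∑[ i < m ] List.sum (map (λ v → F (i ∷ v)) (allVecs m L))
sum-map-allVecs-suc m L F = begin
  List.sum (map F (concatMap (λ i → map (i ∷_) (allVecs m L)) (allFin m)))
    ≡⟨ sum-map-concatMap F (λ i → map (i ∷_) (allVecs m L)) (allFin m) ⟩
  List.sum (map (λ i → List.sum (map F (map (i ∷_) (allVecs m L)))) (allFin m))
    ≡⟨ cong List.sum (map-cong (λ i → cong List.sum (sym (map-∘ (allVecs m L)))) (allFin m)) ⟩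
  List.sum (map (λ i → List.sum (map (λ v → F (i ∷ v)) (allVecs m L))) (allFin m))
    ≡⟨ sum-map-allFin (λ i → List.sum (map (λ v → F (i ∷ v)) (allVecs m L))) ⟩
  ∑[ i < m ] List.sum (map (λ v → F (i ∷ v)) (allVecs m L)) ∎
  where open ≡-Reasoning

sum-map-allVecs-≤ : ∀ {m n} L (h : Fin m → Fin n) → Injective _≡_ _≡_ h →
  (F : Vec (Fin m) L → ℕ) (F′ : Vec (Fin n) L → ℕ) → (∀ v → F v ≤ F′ (Vec.map h v)) →
  List.sum (map F (allVecs m L)) ≤ List.sum (map F′ (allVecs n L))
sum-map-allVecs-≤ zero    h inj F F′ F≤F′ = +-monoˡ-≤ 0 (F≤F′ [])
sum-map-allVecs-≤ {m} {n} (suc L) h inj F F′ F≤F′ = begin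
  List.sum (map F (allVecs m (suc L)))
    ≡⟨ sum-map-allVecs-suc m L F ⟩
  ∑[ i < m ] List.sum (map (λ v → F (i ∷ v)) (allVecs m L))
    ≤⟨ ∑-mono-≤ (λ i → sum-map-allVecs-≤ L h inj _ _ (λ v → F≤F′ (i ∷ v))) ⟩
  ∑[ i < m ] List.sum (map (λ v → F′ (h i ∷ v)) (allVecs n L))
    ≤⟨ ∑-injective-≤ h inj (λ j → List.sum (map (λ v → F′ (j ∷ v)) (allVecs n L))) ⟩
  ∑[ j < n ] List.sum (map (λ v → F′ (j ∷ v)) (allVecs n L))
    ≡⟨ sum-map-allVecs-suc n L F′ ⟨
  List.sum (map F′ (allVecs n (suc L))) ∎
  where open ≤-Reasoning

module _ {m n} {H : Graph m} {G : Graph n} (e : Embedding H G) where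
  open Embedding e

  ⌊f≟f⌋ : ∀ x y → ⌊ f x Finₚ.≟ f y ⌋ ≡ ⌊ x Finₚ.≟ y ⌋
  ⌊f≟f⌋ x y = begin
    ⌊ f x Finₚ.≟ f y ⌋     ≡⟨ isYes≗does (f x Finₚ.≟ f y) ⟩
    does (f x Finₚ.≟ f y)  ≡⟨ does-⇔ (mk⇔ injective (cong f)) (f x Finₚ.≟ f y) (x Finₚ.≟ y) ⟩
    does (x Finₚ.≟ y)      ≡⟨ isYes≗does (x Finₚ.≟ y) ⟨
    ⌊ x Finₚ.≟ y ⌋         ∎
    where open ≡-Reasoning

  walkB-embed : ∀ xs → T (walkB H xs) → T (walkB G (map f xs))
  walkB-embed []           _ = _
  walkB-embed (x ∷ [])     _ = _
  walkB-embed (x ∷ y ∷ xs) w =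
    let xy , rest = Equivalence.to T-∧ w in
    Equivalence.from T-∧ (preserves-adj x y xy , walkB-embed (y ∷ xs) rest)

  distinctB-map : ∀ {L} (v : Vec (Fin m) L) → distinctB (Vec.map f v) ≡ distinctB v
  distinctB-map {L} v = allB-cong (λ i → allB-cong (λ j → cong (λ b → not ⌊ i Finₚ.<? j ⌋ ∨ not b)
    (begin
    ⌊ Vec.lookup (Vec.map f v) i Finₚ.≟ Vec.lookup (Vec.map f v) j ⌋
      ≡⟨ cong₂ (λ y z → ⌊ y Finₚ.≟ z ⌋) (lookup-map i f v) (lookup-map j f v) ⟩
    ⌊ f (Vec.lookup v i) Finₚ.≟ f (Vec.lookup v j) ⌋
      ≡⟨ ⌊f≟f⌋ (Vec.lookup v i) (Vec.lookup v j) ⟩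
    ⌊ Vec.lookup v i Finₚ.≟ Vec.lookup v j ⌋ ∎)) (allFin L)) (allFin L)
    where open ≡-Reasoning

  cycleSeqB-embed : ∀ {L} (v : Vec (Fin m) L) → T (cycleSeqB H v) → T (cycleSeqB G (Vec.map f v))
  cycleSeqB-embed (x ∷ xs) c =
    let walk , closed-distinct = Equivalence.to T-∧ c
        closed , distinct      = Equivalence.to T-∧ closed-distinct
    in Equivalence.from T-∧
      ( subst (λ ys → T (walkB G (f x ∷ ys))) (sym (toList-map f xs)) (walkB-embed (x ∷ Vec.toList xs) walk)
      , Equivalence.from T-∧
        ( subst (λ z → T (adj G z (f x))) (sym (last-map f (x ∷ xs))) (preserves-adj _ x closed)
        , subst T (sym (distinctB-map (x ∷ xs))) distinct))

  labelledCycles-embed : ∀ L → labelledCycles H L ≤ labelledCycles G L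
  labelledCycles-embed L = sum-map-allVecs-≤ L f injective _ _ λ v → ind-1-mono (cycleSeqB-embed v)

  cycles-embed : ∀ L → cycles H L ≤ cycles G L
  cycles-embed zero    = z≤n
  cycles-embed (suc l) = /-monoˡ-≤ (suc (2 * l + 1)) (labelledCycles-embed (suc l))

-- The bipartite graph between A ∩ s and B ∖ s

module _ {n : ℕ} (G : Graph n) (A B : Subset n) where

  arcs : Fin n → Fin n → ℕ
  arcs u v = ind (mem u A ∧ mem v B) (ind (adj G u v) 1)

  arcs-diag : ∀ u → arcs u u ≡ 0
  arcs-diag u = trans (cong (λ c → ind (mem u A ∧ mem u B) (ind c 1)) (irrfl G u)) (if-eta (mem u A ∧ mem u B))

  -- Each edge uv with u < v is counted by the arc (u, v) or by the arc (v, u).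
  eAB≤total-arcs : eAB G A B ≤ total arcs
  eAB≤total-arcs = begin
    eAB G A B                                   ≡⟨ eAB≡total ⟩
    total (λ u v → ind (edge u v) 1)            ≤⟨ total-mono-≤ edge≤arcs ⟩
    total (λ u v → forward u v + backward v u)  ≡⟨ total-+ forward (flip backward) ⟩
    total forward + total (flip backward)       ≡⟨ cong (total forward +_) (total-flip backward) ⟩
    total forward + total backward              ≡⟨ total-+ forward backward ⟨
    total (λ u v → forward u v + backward u v)  ≤⟨ total-mono-≤ forward+backward≤arcs ⟩
    total arcs                                  ∎
    where
    open ≤-Reasoning
    edge : Fin n → Fin n → Bool
    edge u v = ⌊ u Finₚ.<? v ⌋ ∧ adj G u v ∧ ((mem u A ∧ mem v B) ∨ (mem u B ∧ mem v A))
    forward backward : Fin n → Fin n → ℕ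
    forward  u v = ind ⌊ u Finₚ.<? v ⌋ (arcs u v)
    backward u v = ind ⌊ v Finₚ.<? u ⌋ (arcs u v)
    eAB≡total : eAB G A B ≡ total (λ u v → ind (edge u v) 1)
    eAB≡total = trans (sum-map-allFin (λ u → count n (edge u)))
                      (sum-cong-≗ {n} λ u → sum-map-allFin (λ v → ind (edge u v) 1))
    edge≤arcs : ∀ u v → ind (edge u v) 1 ≤ forward u v + backward v u
    edge≤arcs u v = subst (λ r → ind (edge u v) 1 ≤ forward u v + r)
      (cong₂ (λ p c → ind ⌊ u Finₚ.<? v ⌋ (ind p (ind c 1))) (∧-comm (mem u B) (mem v A)) (Graph.sym G u v))
      (ind-∨-≤ ⌊ u Finₚ.<? v ⌋ (adj G u v) (mem u A ∧ mem v B) (mem u B ∧ mem v A))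
    forward+backward≤arcs : ∀ u v → forward u v + backward u v ≤ arcs u v
    forward+backward≤arcs u v with u Finₚ.<? v | v Finₚ.<? u
    ... | yes u<v | yes v<u = ⊥-elim (Finₚ.<-asym u<v v<u)
    ... | yes _   | no  _   = ≤-reflexive (+-identityʳ (arcs u v))
    ... | no  _   | yes _   = ≤-refl
    ... | no  _   | no  _   = z≤n

splitAt-injective : ∀ m {n} → Injective _≡_ _≡_ (splitAt m {n})
splitAt-injective m {n} {i} {j} e = trans (sym (join-splitAt m n i)) (trans (cong (join m n) e) (join-splitAt m n j))

module _ {n : ℕ} (G : Graph n) (p q : Subset n) where

  between : Fin ∣ p ∣ → Fin ∣ q ∣ → Bool
  between x y = adj G (enum p x) (enum q y)

  between-embedding : Disjoint p q → Embedding (bipGraph between) G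
  between-embedding p#q = record
    { f             = embed
    ; injective     = splitAt-injective ∣ p ∣ ∘ [enum,enum]-injective
    ; preserves-adj = adj-preserved
    }
    where
    embed : Fin (∣ p ∣ + ∣ q ∣) → Fin n
    embed = [ enum p , enum q ]′ ∘ splitAt ∣ p ∣
    [enum,enum]-injective : Injective _≡_ _≡_ [ enum p , enum q ]′
    [enum,enum]-injective {inj₁ x} {inj₁ y} e = cong inj₁ (enum-injective p e)
    [enum,enum]-injective {inj₂ x} {inj₂ y} e = cong inj₂ (enum-injective q e)
    [enum,enum]-injective {inj₁ x} {inj₂ y} e =
      ⊥-elim (p#q (enum p x) (mem-enum p x) (subst (λ z → T (mem z q)) (sym e) (mem-enum q y)))
    [enum,enum]-injective {inj₂ x} {inj₁ y} e =
      ⊥-elim (p#q (enum p y) (mem-enum p y) (subst (λ z → T (mem z q)) e (mem-enum q x)))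
    adj-preserved : ∀ u v → T (adj (bipGraph between) u v) → T (adj G (embed u) (embed v))
    adj-preserved u v uv with splitAt ∣ p ∣ u | splitAt ∣ p ∣ v
    ... | inj₁ x | inj₂ y = uv
    ... | inj₂ y | inj₁ x = subst T (Graph.sym G (enum p x) (enum q y)) uv
    ... | inj₁ _ | inj₁ _ = ⊥-elim uv
    ... | inj₂ _ | inj₂ _ = ⊥-elim uv

  bipEdges-between : bipEdges between ≡ ∑[ u < n ] ∑[ v < n ] ind (mem u p) (ind (mem v q) (ind (adj G u v) 1))
  bipEdges-between = begin
    bipEdges between
      ≡⟨ sum-map-allFin (λ x → count ∣ q ∣ (between x)) ⟩
    ∑[ x < ∣ p ∣ ] count ∣ q ∣ (between x)
      ≡⟨ sum-cong-≗ {∣ p ∣} (λ x → trans (sum-map-allFin (λ y → ind (between x y) 1))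
                                         (∑-enum q (adjacent (enum p x)))) ⟩
    ∑[ x < ∣ p ∣ ] ∑[ v < n ] ind (mem v q) (adjacent (enum p x) v)
      ≡⟨ ∑-enum p (λ u → ∑[ v < n ] ind (mem v q) (adjacent u v)) ⟩
    ∑[ u < n ] ind (mem u p) (∑[ v < n ] ind (mem v q) (adjacent u v))
      ≡⟨ sum-cong-≗ {n} (λ u → ind-∑ (mem u p) (λ v → ind (mem v q) (adjacent u v))) ⟩
    ∑[ u < n ] ∑[ v < n ] ind (mem u p) (ind (mem v q) (adjacent u v)) ∎
    where
    open ≡-Reasoning
    adjacent : Fin n → Fin n → ℕ
    adjacent u v = ind (adj G u v) 1

cut-arcs : ∀ {n} (G : Graph n) (A B s : Subset n) →
           cut (arcs G A B) s ≡ bipEdges (between G (A ∩ s) (B ∩ ∁ s))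
cut-arcs {n} G A B s = sym (trans (bipEdges-between G (A ∩ s) (B ∩ ∁ s))
                                  (sum-cong-≗ {n} λ u → sum-cong-≗ {n} λ v →
  let x = ind (adj G u v) 1 in begin
    ind (mem u (A ∩ s)) (ind (mem v (B ∩ ∁ s)) x)
      ≡⟨ cong₂ (λ a b → ind a (ind b x))
               (mem-∩ u A s) (trans (mem-∩ v B (∁ s)) (cong (mem v B ∧_) (mem-∁ v s))) ⟩
    ind (mem u A ∧ mem u s) (ind (mem v B ∧ not (mem v s)) x)
      ≡⟨ ind-∧-interchange (mem u A) (mem u s) (mem v B) (not (mem v s)) x ⟩
    ind (mem u s ∧ not (mem v s)) (ind (mem u A ∧ mem v B) x) ∎))
  where open ≡-Reasoning

-- Arithmetic of the supersaturation bound

iroot : ∀ p .{{_ : NonZero p}} N → ∃[ y ] (y ^ p ≤ N × N < suc y ^ p)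
iroot p@(suc _) zero = 0 , z≤n , subst (0 <_) (sym (^-zeroˡ p)) z<s
iroot p (suc N) with iroot p N
... | y , yᵖ≤N , N<[1+y]ᵖ with suc y ^ p ≤? suc N
...   | yes [1+y]ᵖ≤1+N = suc y , [1+y]ᵖ≤1+N , <-≤-trans (s≤s N<[1+y]ᵖ) (^-monoˡ-< p (n<1+n (suc y)))
...   | no  [1+y]ᵖ≰1+N = y , m≤n⇒m≤1+n yᵖ≤N , ≰⇒> [1+y]ᵖ≰1+N

^-distribʳ-* : ∀ x y n → (x * y) ^ n ≡ x ^ n * y ^ n
^-distribʳ-* x y zero    = refl
^-distribʳ-* x y (suc n) = begin
  x * y * (x * y) ^ n        ≡⟨ cong (x * y *_) (^-distribʳ-* x y n) ⟩
  x * y * (x ^ n * y ^ n)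
    ≡⟨ solve 4 (λ x y u v → x :* y :* (u :* v) := x :* u :* (y :* v)) refl x y (x ^ n) (y ^ n) ⟩
  x * x ^ n * (y * y ^ n)    ∎
  where open ≡-Reasoning

^-cancelˡ-< : ∀ n {x y} → x ^ n < y ^ n → x < y
^-cancelˡ-< n {x} {y} xⁿ<yⁿ with y ≤? x
... | yes y≤x = ⊥-elim (<⇒≱ xⁿ<yⁿ (^-monoˡ-≤ n y≤x))
... | no  y≰x = ≰⇒> y≰x

module _ {p K d k r a b t y₁ y₂ : ℕ} .{{_ : NonZero p}} .{{_ : NonZero d}} where

  sparse-case : ∀ {x} → x ^ p < K ^ p * (a * b) ^ r → (a * b) ^ r < suc y₁ ^ p → x < K * suc y₁
  sparse-case {x} xᵖ< [ab]ʳ< = ^-cancelˡ-< p (begin-strict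
    x ^ p                  <⟨ xᵖ< ⟩
    K ^ p * (a * b) ^ r    ≤⟨ *-monoʳ-≤ (K ^ p) (<⇒≤ [ab]ʳ<) ⟩
    K ^ p * suc y₁ ^ p     ≡⟨ ^-distribʳ-* K (suc y₁) p ⟨
    (K * suc y₁) ^ p       ∎)
    where open ≤-Reasoning

  dense-case : ∀ {m} → m ^ p ≤ d * t * a ^ k * b ^ k → t * (a * b) ^ k < suc y₂ ^ p → m < d * suc y₂
  dense-case {m} mᵖ≤ t[ab]ᵏ< = ^-cancelˡ-< p (begin-strict
    m ^ p                      ≤⟨ mᵖ≤ ⟩
    d * t * a ^ k * b ^ k      ≡⟨ *-assoc (d * t) (a ^ k) (b ^ k) ⟩
    d * t * (a ^ k * b ^ k)    ≡⟨ *-assoc d t (a ^ k * b ^ k) ⟩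
    d * (t * (a ^ k * b ^ k))  ≡⟨ cong (λ z → d * (t * z)) (^-distribʳ-* a b k) ⟨
    d * (t * (a * b) ^ k)      <⟨ *-monoʳ-< d t[ab]ᵏ< ⟩
    d * suc y₂ ^ p             ≤⟨ *-monoˡ-≤ (suc y₂ ^ p) d≤dᵖ ⟩
    d ^ p * suc y₂ ^ p         ≡⟨ ^-distribʳ-* d (suc y₂) p ⟨
    (d * suc y₂) ^ p           ∎)
    where
    open ≤-Reasoning
    d≤dᵖ : d ≤ d ^ p
    d≤dᵖ = subst (_≤ d ^ p) (^-identityʳ d) (^-monoʳ-≤ d (>-nonZero⁻¹ p))

  supersaturation-bound : ∀ {m} →
    (a * b) ^ r < suc y₁ ^ p → t * (a * b) ^ k < suc y₂ ^ p →
    (K * (a + b) ≤ m → K ^ p * (a * b) ^ r ≤ (m ∸ K * (a + b)) ^ p → m ^ p ≤ d * t * a ^ k * b ^ k) →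
    m ≤ K * (a + b) + K * suc y₁ + d * suc y₂
  supersaturation-bound {m} [ab]ʳ< t[ab]ᵏ< supersaturated with m <? K * (a + b)
  ... | yes m<K[a+b] = ≤-trans (<⇒≤ m<K[a+b]) (≤-trans (m≤m+n _ (K * suc y₁)) (m≤m+n _ (d * suc y₂)))
  ... | no  m≮K[a+b] with K ^ p * (a * b) ^ r ≤? (m ∸ K * (a + b)) ^ p
  ...   | yes dense  = ≤-trans (<⇒≤ (dense-case (supersaturated (≮⇒≥ m≮K[a+b]) dense) t[ab]ᵏ<))
                               (m≤n+m (d * suc y₂) _)
  ...   | no  sparse = begin
    m                                        ≡⟨ m+[n∸m]≡n (≮⇒≥ m≮K[a+b]) ⟨
    K * (a + b) + (m ∸ K * (a + b))          ≤⟨ +-monoʳ-≤ _ (<⇒≤ (sparse-case (≰⇒> sparse) [ab]ʳ<)) ⟩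
    K * (a + b) + K * suc y₁                 ≤⟨ m≤m+n _ (d * suc y₂) ⟩
    K * (a + b) + K * suc y₁ + d * suc y₂    ∎
    where open ≤-Reasoning

affine≤linear : ∀ K d a b y₁ y₂ → 1 ≤ a →
  K * (a + b) + K * suc y₁ + d * suc y₂ ≤ 2 * (K + d) * (a + b + y₁ + y₂)
affine≤linear K d a b y₁ y₂ 1≤a = begin
  K * (a + b) + K * suc y₁ + d * suc y₂
    ≡⟨ solve 6 (λ K d a b y₁ y₂ → K :* (a :+ b) :+ K :* (con 1 :+ y₁) :+ d :* (con 1 :+ y₂)
                                := (K :+ d) :* con 1 :+ (K :* (a :+ b) :+ K :* y₁ :+ d :* y₂))
               refl K d a b y₁ y₂ ⟩
  (K + d) * 1 + (K * (a + b) + K * y₁ + d * y₂)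
    ≤⟨ +-mono-≤ (*-monoʳ-≤ (K + d) 1≤Z) (m≤m+n _ (d * (a + b + y₁) + K * y₂)) ⟩
  (K + d) * Z + (K * (a + b) + K * y₁ + d * y₂ + (d * (a + b + y₁) + K * y₂))
    ≡⟨ solve 6 (λ K d a b y₁ y₂ → (K :+ d) :* (a :+ b :+ y₁ :+ y₂)
                                  :+ (K :* (a :+ b) :+ K :* y₁ :+ d :* y₂ :+ (d :* (a :+ b :+ y₁) :+ K :* y₂))
                                := con 2 :* (K :+ d) :* (a :+ b :+ y₁ :+ y₂))
               refl K d a b y₁ y₂ ⟩
  2 * (K + d) * Z ∎
  where
  open ≤-Reasoning
  Z = a + b + y₁ + y₂
  1≤Z : 1 ≤ Z
  1≤Z = ≤-trans 1≤a (≤-trans (m≤m+n a b) (≤-trans (m≤m+n (a + b) y₁) (m≤m+n (a + b + y₁) y₂)))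

bipEdges-bound : ∀ k .{{_ : NonZero k}} (usc : USC k) {a b} (R : Fin a → Fin b → Bool) {y₁ y₂} →
  (a * b) ^ (k + 1) < suc y₁ ^ (2 * k) →
  cycles (bipGraph R) (2 * k) * (a * b) ^ k < suc y₂ ^ (2 * k) →
  bipEdges R ≤ 2 * (100 * k + proj₁ usc) * (a + b + y₁ + y₂)
bipEdges-bound k _ {zero} R _ _ = z≤n
bipEdges-bound k (d , 1≤d , supersaturation) {suc a} {b} R {y₁} {y₂} [ab]ʳ< t[ab]ᵏ< =
  ≤-trans (supersaturation-bound {k = k} {r = k + 1} {a = suc a} {b = b} {{m*n≢0 2 k}} {{>-nonZero 1≤d}}
                                 [ab]ʳ< t[ab]ᵏ< (supersaturation (suc a) b R))
          (affine≤linear (100 * k) d (suc a) b y₁ y₂ (s≤s z≤n))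

eAB-bound : ∀ k .{{_ : NonZero k}} (usc : USC k) {n} (G : Graph n) (A B : Subset n) {y₁ y₂} →
  (∣ A ∣ * ∣ B ∣) ^ (k + 1) < suc y₁ ^ (2 * k) →
  cycles G (2 * k) * (∣ A ∣ * ∣ B ∣) ^ k < suc y₂ ^ (2 * k) →
  eAB G A B ≤ 8 * (100 * k + proj₁ usc) * (∣ A ∣ + ∣ B ∣ + y₁ + y₂)
eAB-bound k usc G A B {y₁} {y₂} [ab]ʳ< t[ab]ᵏ< with largeCut (arcs G A B) (arcs-diag G A B)
... | s , total≤cut = begin
  eAB G A B                                 ≤⟨ eAB≤total-arcs G A B ⟩
  total (arcs G A B)                        ≤⟨ total≤cut ⟩
  4 * cut (arcs G A B) s                    ≡⟨ cong (4 *_) (cut-arcs G A B s) ⟩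
  4 * bipEdges R                            ≤⟨ *-monoʳ-≤ 4 (bipEdges-bound k usc R ab′< tab′<) ⟩
  4 * (2 * C * (a′ + b′ + y₁ + y₂))
    ≤⟨ *-monoʳ-≤ 4 (*-monoʳ-≤ (2 * C) (+-monoˡ-≤ y₂ (+-monoˡ-≤ y₁ (+-mono-≤ a′≤a b′≤b)))) ⟩
  4 * (2 * C * (∣ A ∣ + ∣ B ∣ + y₁ + y₂))
    ≡⟨ solve 2 (λ C z → con 4 :* (con 2 :* C :* z) := con 8 :* C :* z) refl C (∣ A ∣ + ∣ B ∣ + y₁ + y₂) ⟩
  8 * C * (∣ A ∣ + ∣ B ∣ + y₁ + y₂)         ∎
  where
  open ≤-Reasoning
  C = 100 * k + proj₁ usc
  A′ = A ∩ s
  B′ = B ∩ ∁ s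
  a′ = ∣ A′ ∣
  b′ = ∣ B′ ∣
  R = between G A′ B′
  a′≤a : a′ ≤ ∣ A ∣
  a′≤a = ∣p∩q∣≤∣p∣ A s
  b′≤b : b′ ≤ ∣ B ∣
  b′≤b = ∣p∩q∣≤∣p∣ B (∁ s)
  a′b′≤ab : a′ * b′ ≤ ∣ A ∣ * ∣ B ∣
  a′b′≤ab = *-mono-≤ a′≤a b′≤b
  ab′< : (a′ * b′) ^ (k + 1) < suc y₁ ^ (2 * k)
  ab′< = ≤-<-trans (^-monoˡ-≤ (k + 1) a′b′≤ab) [ab]ʳ<
  tab′< : cycles (bipGraph R) (2 * k) * (a′ * b′) ^ k < suc y₂ ^ (2 * k)
  tab′< = ≤-<-trans (*-mono-≤ (cycles-embed (between-embedding G A′ B′ (∩-∩∁-disjoint A B s)) (2 * k))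
                              (^-monoˡ-≤ k a′b′≤ab)) t[ab]ᵏ<

corollaryA1 : (k : ℕ) → 2 ≤ k → USC k →
    ∃[ C ] (∀ (n : ℕ) (G : Graph n) (A B : Subset n) →
      ∃[ y₁ ] ∃[ y₂ ]
        (y₁ ^ (2 * k) ≤ (∣ A ∣ * ∣ B ∣) ^ (k + 1)) ×
        (y₂ ^ (2 * k) ≤ cycles G (2 * k) * (∣ A ∣ * ∣ B ∣) ^ k) ×
        (eAB G A B ≤ C * (∣ A ∣ + ∣ B ∣ + y₁ + y₂)))
corollaryA1 k@(suc _) _ usc = 8 * (100 * k + proj₁ usc) , λ n G A B →
  let y₁ , y₁ᵖ≤ , <[1+y₁]ᵖ = iroot (2 * k) ((∣ A ∣ * ∣ B ∣) ^ (k + 1))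
      y₂ , y₂ᵖ≤ , <[1+y₂]ᵖ = iroot (2 * k) (cycles G (2 * k) * (∣ A ∣ * ∣ B ∣) ^ k)
  in y₁ , y₂ , y₁ᵖ≤ , y₂ᵖ≤ , eAB-bound k usc G A B <[1+y₁]ᵖ <[1+y₂]ᵖ
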